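{- For every integer $n\geq 3$, $I\!R_b(C_n)=\Gamma_b(C_n)$, where $C_n$ is the cycle of order $n$.
   Context: For a graph $G=(V,E)$, a broadcast is a function $f:V\to\{0,\dots,\operatorname{diam}(G)\}$ with $f(v)\le e_G(v)$ (eccentricity) for all $v$. Let $V^+_f=\{v: f(v)>0\}$ and $H_f(u)=\{v\in V^+_f: d_G(u,v)\le f(v)\}$. For $v\in V^+_f$, $PN_f(v)=\{u\in V: H_f(u)=\{v\}\}$, and $PB_f(v)$ is $\{v\}$ if $f(v)=1$ and $PN_f(v)=\{v\}$, and otherwise $PB_f(v)=\{u\in PN_f(v): d_G(u,v)=f(v)\}$. The cost is $\sigma(f)=\sum_v f(v)$. A broadcast of some type is minimal if no other broadcast $g\ne f$ of the same type satisfies $g\le f$ pointwise. $f$ is dominating if $|H_f(u)|\ge1$ for all $u\in V$; $\Gamma_b(G)$ is the maximum cost of a minimal dominating broadcast. $f$ is irredundant if $PB_f(v)\ne\emptyset$ for every $v\in V^+_f$; $I\!R_b(G)$ is the maximum cost of an irredundant broadcast. -}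

module Defs where

open import Data.Nat using (ℕ; zero; suc; _+_; _∸_; _≤_; _<_; _⊓_; ∣_-_∣)
open import Data.Fin using (Fin; toℕ)
open import Data.List using (List; map; allFin)
open import Data.Nat.ListAction using (sum)
open import Data.Product using (Σ; _×_; ∃; ∃-syntax)
open import Data.Sum using (_⊎_)
open import Relation.Nullary using (¬_)
open import Relation.Binary.PropositionalEquality using (_≡_)
open import Function.Bundles using (_⇔_)

-- Vertices of the cycle C_n are Fin n, with i adjacent to i ± 1 (mod n).
-- Distance in C_n: d(i,j) = min(|i-j|, n-|i-j|).
dist : (n : ℕ) → Fin n → Fin n → ℕ
dist n i j = ∣ toℕ i - toℕ j ∣ ⊓ (n ∸ ∣ toℕ i - toℕ j ∣)

-- f(v) ≤ e(v), where e(v) = max_u d(v,u); equivalently some u has f(v) ≤ d(v,u).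
-- (This also gives f(v) ≤ diam.)
IsBroadcast : (n : ℕ) → (Fin n → ℕ) → Set
IsBroadcast n f = (v : Fin n) → ∃[ u ] (f v ≤ dist n v u)

cost : (n : ℕ) → (Fin n → ℕ) → ℕ
cost n f = sum (map f (allFin n))

InH : (n : ℕ) → (Fin n → ℕ) → Fin n → Fin n → Set
InH n f u v = (0 < f v) × (dist n u v ≤ f v)

IsDominating : (n : ℕ) → (Fin n → ℕ) → Set
IsDominating n f = (u : Fin n) → ∃[ v ] InH n f u v

IsMinimalDominating : (n : ℕ) → (Fin n → ℕ) → Set
IsMinimalDominating n f =
  IsBroadcast n f × IsDominating n f ×
  ((g : Fin n → ℕ) → IsBroadcast n g → IsDominating n g →
     ((v : Fin n) → g v ≤ f v) → (v : Fin n) → g v ≡ f v)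

InPN : (n : ℕ) → (Fin n → ℕ) → Fin n → Fin n → Set
InPN n f v u = (w : Fin n) → InH n f u w ⇔ (w ≡ v)

PBSpecial : (n : ℕ) → (Fin n → ℕ) → Fin n → Set
PBSpecial n f v = (f v ≡ 1) × ((u : Fin n) → InPN n f v u ⇔ (u ≡ v))

InPB : (n : ℕ) → (Fin n → ℕ) → Fin n → Fin n → Set
InPB n f v u =
  (PBSpecial n f v × u ≡ v) ⊎
  (¬ PBSpecial n f v × InPN n f v u × dist n u v ≡ f v)

IsIrredundant : (n : ℕ) → (Fin n → ℕ) → Set
IsIrredundant n f =
  IsBroadcast n f × ((v : Fin n) → 0 < f v → ∃[ u ] InPB n f v u)

IsMaxCost : (n : ℕ) → ((Fin n → ℕ) → Set) → ℕ → Set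
IsMaxCost n P k =
  (∃[ f ] (P f × cost n f ≡ k)) × ((f : Fin n → ℕ) → P f → cost n f ≤ k)

IsIRb : ℕ → ℕ → Set
IsIRb n k = IsMaxCost n (IsIrredundant n) k

IsUpperBroadcastDom : ℕ → ℕ → Set
IsUpperBroadcastDom n k = IsMaxCost n (IsMinimalDominating n) k

module Submission where

-- In an irredundant broadcast f on C_n charge every broadcaster v with a block of f(v) vertices: {v}
-- when PB_f(v) = {v} is the special case, and otherwise the arc walked from v to a boundary private
-- neighbour u (v excluded, u included). Since u hears only v, no other broadcaster lies on that arc and
-- no other block meets it, so σ(f) ≤ n − e whenever e vertices lie outside all blocks. Two such vertices
-- always exist (the neighbours of a special broadcaster, or the centres of two non-special ones) unless
-- there is at most one broadcaster, whose power is at most n/2; for odd n ≥ 5 a third one exists unless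
-- there are two broadcasters only, each of power at most n/2 − 1 as it cannot reach the other's private
-- neighbour. Hence σ(f) ≤ n − 2, and σ(f) ≤ n − 3 for odd n ≥ 5. A minimal dominating broadcast is
-- irredundant, since otherwise one broadcaster could lower its power by one, and two balls of equal radius
-- (one ball when n = 3) give a broadcast that is both minimal dominating and irredundant and attains the bound.

open import Defs
open import Data.Nat
  using (ℕ; zero; suc; _+_; _*_; _∸_; _≤_; _<_; _⊓_; ∣_-_∣; z≤n; s≤s; NonZero; >-nonZero⁻¹; _≤?_; _<?_; _≟_)
open import Data.Nat.Properties
open import Data.Nat.DivMod using (_%_; _/_; m≡m%n+[m/n]*n; m%n<n; [m+kn]%n≡m%n; m<n⇒m%n≡m)
open import Data.Nat.Tactic.RingSolver using (solve-∀)
open import Data.Fin as Fin using (Fin; toℕ; fromℕ<)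
open import Data.Fin.Properties
  using (toℕ-injective; toℕ<n; toℕ-fromℕ<; any?; all?; injective⇒≤) renaming (_≟_ to _≟ᶠ_)
open import Data.List using (List; []; _∷_; _++_; map; concat; allFin; length; lookup)
open import Data.List.Properties using (length-++; map-cong)
open import Data.Nat.ListAction using (sum)
open import Data.List.Membership.Propositional using (_∈_; _∉_)
open import Data.List.Relation.Binary.Disjoint.Propositional using (Disjoint)
open import Data.List.Membership.Propositional.Properties using (∈-allFin; ∈-concat⁻; ∈-lookup)
open import Data.List.Relation.Unary.Any using (here; there; satisfied)
open import Data.List.Relation.Unary.Any.Properties using (map⁻)
open import Data.List.Relation.Unary.All as All using (All)
open import Data.List.Relation.Unary.All.Properties using (map⁺)
open import Data.List.Relation.Unary.AllPairs as AllPairs using ([]; _∷_)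
import Data.List.Relation.Unary.AllPairs.Properties as AllPairs
open import Data.List.Relation.Unary.Unique.Propositional using (Unique)
open import Data.List.Relation.Unary.Unique.Propositional.Properties using (allFin⁺; ++⁺; concat⁺)
open import Data.Product using (_×_; _,_; -,_; proj₁; proj₂; ∃; ∃-syntax)
open import Data.Sum using (_⊎_; inj₁; inj₂; [_,_]′)
open import Data.Empty using (⊥; ⊥-elim)
open import Relation.Nullary using (¬_; Dec; yes; no)
open import Relation.Nullary.Decidable using (map′; _×-dec_; _→-dec_; ¬?)
open import Function.Bundles using (_⇔_; mk⇔; Equivalence)
open import Relation.Binary.PropositionalEquality
open import Function using (_∘′_)

_⇔-dec_ : ∀ {A B : Set} → Dec A → Dec B → Dec (A ⇔ B)
a? ⇔-dec b? = map′ (λ (to , from) → mk⇔ to from) (λ e → Equivalence.to e , Equivalence.from e)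
                   ((a? →-dec b?) ×-dec (b? →-dec a?))

lookup-injective : ∀ {A : Set} {xs : List A} → Unique xs → ∀ {i j} → lookup xs i ≡ lookup xs j → i ≡ j
lookup-injective (_    ∷ _) {Fin.zero}  {Fin.zero}  _ = refl
lookup-injective (x∉xs ∷ _) {Fin.zero}  {Fin.suc j} e = ⊥-elim (All.lookup x∉xs (∈-lookup j) e)
lookup-injective (x∉xs ∷ _) {Fin.suc i} {Fin.zero}  e = ⊥-elim (All.lookup x∉xs (∈-lookup i) (sym e))
lookup-injective (_    ∷ u) {Fin.suc i} {Fin.suc j} e = cong Fin.suc (lookup-injective u e)

unique-length≤ : ∀ {m} {xs : List (Fin m)} → Unique xs → length xs ≤ m
unique-length≤ u = injective⇒≤ (lookup-injective u)

length-concat-map : ∀ {A B : Set} (g : A → List B) xs →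
                    length (concat (map g xs)) ≡ sum (map (length ∘′ g) xs)
length-concat-map g []       = refl
length-concat-map g (x ∷ xs) = trans (length-++ (g x)) (cong (length (g x) +_) (length-concat-map g xs))

half-≤ : ∀ x y → x + x ≤ suc (y + y) → x ≤ y
half-≤ x y 2x≤ = ≮⇒≥ λ y<x →
  1+n≰n (≤-trans (≤-reflexive (cong suc (sym (+-suc y y)))) (≤-trans (+-mono-≤ y<x y<x) 2x≤))

odd-lone-≤ : ∀ {x} m → x + x ≤ 5 + (m + m) → x ≤ 2 + (m + m)
odd-lone-≤ {x} m 2x≤ = ≤-trans (half-≤ x (2 + m) (subst (x + x ≤_) (solve m) 2x≤)) (+-monoʳ-≤ 2 (m≤m+n m m))
  where
  solve : ∀ m → 5 + (m + m) ≡ suc ((2 + m) + (2 + m))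
  solve = solve-∀

odd-pair-≤ : ∀ {x y} m → suc x + suc x ≤ 5 + (m + m) → suc y + suc y ≤ 5 + (m + m) → x + y ≤ 2 + (m + m)
odd-pair-≤ {x} {y} m 2x≤ 2y≤ =
  ≤-trans (+-mono-≤ (≤-pred (half m 2x≤)) (≤-pred (half m 2y≤))) (≤-reflexive (cong suc (+-suc m m)))
  where
  half : ∀ {z} m → suc z + suc z ≤ 5 + (m + m) → suc z ≤ 2 + m
  half {z} m 2z≤ = half-≤ (suc z) (2 + m) (subst (suc z + suc z ≤_) (solve m) 2z≤)
    where
    solve : ∀ m → 5 + (m + m) ≡ suc ((2 + m) + (2 + m))
    solve = solve-∀

half-≤∸2 : ∀ {x n} → 3 ≤ n → x + x ≤ n → x ≤ n ∸ 2
half-≤∸2 {x} 3≤n 2x≤n with x ≤? 1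
... | yes x≤1 = ≤-trans x≤1 (m+n≤o⇒m≤o∸n 1 3≤n)
... | no  x≰1 = m+n≤o⇒m≤o∸n x (≤-trans (+-monoʳ-≤ x (≰⇒> x≰1)) 2x≤n)

sum-map-+ : ∀ {A : Set} (f g : A → ℕ) xs →
            sum (map (λ x → f x + g x) xs) ≡ sum (map f xs) + sum (map g xs)
sum-map-+ f g []       = refl
sum-map-+ f g (x ∷ xs) = trans (cong (f x + g x +_) (sum-map-+ f g xs)) (+-+-comm (f x) (g x) _ _)
  where
  +-+-comm : ∀ a b c d → a + b + (c + d) ≡ a + c + (b + d)
  +-+-comm = solve-∀

sum-map-mono : ∀ {A : Set} {f g : A → ℕ} → (∀ x → f x ≤ g x) → ∀ xs → sum (map f xs) ≤ sum (map g xs)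
sum-map-mono f≤g []       = z≤n
sum-map-mono f≤g (x ∷ xs) = +-mono-≤ (f≤g x) (sum-map-mono f≤g xs)

module Cycle (n : ℕ) .{{_ : NonZero n}} where

  V : Set
  V = Fin n

  -- Walks and distances on the cycle

  residue-unique : ∀ {a b} k l → a < n → b < n → a + k * n ≡ b + l * n → a ≡ b
  residue-unique {a} {b} k l a<n b<n eq = begin
    a               ≡⟨ m<n⇒m%n≡m a<n ⟨
    a % n           ≡⟨ [m+kn]%n≡m%n a k n ⟨
    (a + k * n) % n ≡⟨ cong (_% n) eq ⟩
    (b + l * n) % n ≡⟨ [m+kn]%n≡m%n b l n ⟩
    b % n           ≡⟨ m<n⇒m%n≡m b<n ⟩
    b               ∎
    where open ≡-Reasoning

  vertex-unique : ∀ {x y : V} k l → toℕ x + k * n ≡ toℕ y + l * n → x ≡ y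
  vertex-unique {x} {y} k l eq = toℕ-injective (residue-unique k l (toℕ<n x) (toℕ<n y) eq)

  data Fwd (x : V) (j : ℕ) (y : V) : Set where
    fwd : ∀ k → toℕ x + j ≡ toℕ y + k * n → Fwd x j y

  fwd-exists : ∀ x j → ∃[ y ] Fwd x j y
  fwd-exists x j = fromℕ< (m%n<n a n) , fwd (a / n)
    (trans (m≡m%n+[m/n]*n a n) (cong (_+ (a / n) * n) (sym (toℕ-fromℕ< (m%n<n a n)))))
    where a = toℕ x + j

  fwd-target-unique : ∀ {x j y z} → Fwd x j y → Fwd x j z → y ≡ z
  fwd-target-unique (fwd k e) (fwd l e′) = vertex-unique k l (trans (sym e) e′)

  fwd-source-unique : ∀ {y z j w} → Fwd y j w → Fwd z j w → y ≡ z
  fwd-source-unique {y} {z} {j} {w} (fwd k e) (fwd l e′) =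
    vertex-unique l k (+-cancelʳ-≡ j _ _ (begin
      toℕ y + l * n + j     ≡⟨ swap (toℕ y) (l * n) j ⟩
      toℕ y + j + l * n     ≡⟨ cong (_+ l * n) e ⟩
      toℕ w + k * n + l * n ≡⟨ swap (toℕ w) (k * n) (l * n) ⟩
      toℕ w + l * n + k * n ≡⟨ cong (_+ k * n) e′ ⟨
      toℕ z + j + k * n     ≡⟨ swap (toℕ z) j (k * n) ⟩
      toℕ z + k * n + j     ∎))
    where
    open ≡-Reasoning
    swap : ∀ a b c → a + b + c ≡ a + c + b
    swap = solve-∀

  fwd-trans : ∀ {x i y j z} → Fwd x i y → Fwd y j z → Fwd x (i + j) z
  fwd-trans {x} {i} {y} {j} {z} (fwd k e) (fwd l e′) = fwd (l + k) (begin
    toℕ x + (i + j)       ≡⟨ +-assoc (toℕ x) i j ⟨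
    toℕ x + i + j         ≡⟨ cong (_+ j) e ⟩
    toℕ y + k * n + j     ≡⟨ swap (toℕ y) (k * n) j ⟩
    toℕ y + j + k * n     ≡⟨ cong (_+ k * n) e′ ⟩
    toℕ z + l * n + k * n ≡⟨ collect (toℕ z) l k n ⟩
    toℕ z + (l + k) * n   ∎)
    where
    open ≡-Reasoning
    swap : ∀ a b c → a + b + c ≡ a + c + b
    swap = solve-∀
    collect : ∀ a b c n → a + b * n + c * n ≡ a + (b + c) * n
    collect = solve-∀

  fwd-zero : ∀ {x y} → Fwd x 0 y → x ≡ y
  fwd-zero (fwd k e) = vertex-unique 0 k e

  fwd-loop : ∀ {x j} → Fwd x j x → j ≡ 0 ⊎ n ≤ j
  fwd-loop {x} {j} (fwd zero e)    = inj₁ (+-cancelˡ-≡ (toℕ x) j 0 e)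
  fwd-loop {x} {j} (fwd (suc k) e) =
    inj₂ (≤-trans (m≤m+n n (k * n)) (≤-reflexive (sym (+-cancelˡ-≡ (toℕ x) j _ e))))

  dist-sym : ∀ x y → dist n x y ≡ dist n y x
  dist-sym x y = cong (λ D → D ⊓ (n ∸ D)) (∣-∣-comm (toℕ x) (toℕ y))

  dist-refl : ∀ x → dist n x x ≡ 0
  dist-refl x = cong (λ D → D ⊓ (n ∸ D)) (∣n-n∣≡0 (toℕ x))

  fwd-dist : ∀ {x j y} → Fwd x j y → dist n x y ≤ j
  fwd-dist {x} {j} {y} (fwd zero e) = ≤-trans (m⊓n≤m _ _) (≤-reflexive (begin
    ∣ toℕ x - toℕ y ∣     ≡⟨ cong (λ b → ∣ toℕ x - b ∣) (trans (sym (+-identityʳ (toℕ y))) (sym e)) ⟩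
    ∣ toℕ x - toℕ x + j ∣ ≡⟨ ∣m-m+n∣≡n (toℕ x) j ⟩
    j                     ∎))
    where open ≡-Reasoning
  fwd-dist {x} {j} {y} (fwd (suc k) e) =
    ≤-trans (m⊓n≤n _ _) (m≤n+o⇒m∸n≤o n _ (+-cancelʳ-≤ b n (∣ a - b ∣ + j) (begin
      n + b             ≤⟨ m≤m+n (n + b) (k * n) ⟩
      n + b + k * n     ≡⟨ shuffle b n (k * n) ⟩
      b + (n + k * n)   ≡⟨ e ⟨
      a + j             ≤⟨ +-monoˡ-≤ j (m≤n+∣m-n∣ a b) ⟩
      b + ∣ a - b ∣ + j ≡⟨ rotate b ∣ a - b ∣ j ⟩
      ∣ a - b ∣ + j + b ∎)))
    where
    open ≤-Reasoning
    a = toℕ x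
    b = toℕ y
    shuffle : ∀ b n c → n + b + c ≡ b + (n + c)
    shuffle = solve-∀
    rotate : ∀ b d j → b + d + j ≡ d + j + b
    rotate = solve-∀

  private
    gap≤n : ∀ x y → ∣ toℕ x - toℕ y ∣ ≤ n
    gap≤n x y = ≤-trans (∣m-n∣≤m⊔n (toℕ x) (toℕ y)) (⊔-lub (<⇒≤ (toℕ<n x)) (<⇒≤ (toℕ<n y)))

    fwd-geodesic-≤ : ∀ x y → toℕ x ≤ toℕ y → Fwd x (dist n x y) y ⊎ Fwd y (dist n x y) x
    fwd-geodesic-≤ x y a≤b with ∣ toℕ x - toℕ y ∣ ≤? n ∸ ∣ toℕ x - toℕ y ∣
    ... | yes D≤ = inj₁ (subst (λ e → Fwd x e y) (sym (m≤n⇒m⊓n≡m D≤)) (fwd 0 (begin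
      toℕ x + ∣ toℕ x - toℕ y ∣ ≡⟨ cong (toℕ x +_) (m≤n⇒∣m-n∣≡n∸m a≤b) ⟩
      toℕ x + (toℕ y ∸ toℕ x)   ≡⟨ m+[n∸m]≡n a≤b ⟩
      toℕ y                     ≡⟨ +-identityʳ (toℕ y) ⟨
      toℕ y + 0 * n             ∎)))
      where open ≡-Reasoning
    ... | no D≰ = inj₂ (subst (λ e → Fwd y e x) (sym (m≥n⇒m⊓n≡n (≰⇒≥ D≰))) (fwd 1 (begin
      b + (n ∸ D)       ≡⟨ cong (_+ (n ∸ D)) (trans (cong (a +_) D≡) (m+[n∸m]≡n a≤b)) ⟨
      a + D + (n ∸ D)   ≡⟨ +-assoc a D (n ∸ D) ⟩
      a + (D + (n ∸ D)) ≡⟨ cong (a +_) (m+[n∸m]≡n (gap≤n x y)) ⟩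
      a + n             ≡⟨ cong (a +_) (+-identityʳ n) ⟨
      a + 1 * n         ∎)))
      where
      open ≡-Reasoning
      a = toℕ x
      b = toℕ y
      D = ∣ a - b ∣
      D≡ : D ≡ b ∸ a
      D≡ = m≤n⇒∣m-n∣≡n∸m a≤b

  fwd-geodesic : ∀ x y → Fwd x (dist n x y) y ⊎ Fwd y (dist n x y) x
  fwd-geodesic x y with ≤-total (toℕ x) (toℕ y)
  ... | inj₁ x≤y = fwd-geodesic-≤ x y x≤y
  ... | inj₂ y≤x with fwd-geodesic-≤ y x y≤x
  ...   | inj₁ g = inj₂ (subst (λ e → Fwd y e x) (dist-sym y x) g)
  ...   | inj₂ g = inj₁ (subst (λ e → Fwd x e y) (dist-sym y x) g)

  fwd-ending-exists : ∀ x j → ∃[ y ] Fwd y j x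
  fwd-ending-exists x j = y , subst (Fwd y j) (fwd-target-unique (fwd-trans x→y y→x′) around) y→x′
    where
    y = proj₁ (fwd-exists x (j * (n ∸ 1)))
    x→y = proj₂ (fwd-exists x (j * (n ∸ 1)))
    y→x′ = proj₂ (fwd-exists y j)
    around : Fwd x (j * (n ∸ 1) + j) x
    around = fwd j (cong (toℕ x +_) (begin
      j * (n ∸ 1) + j ≡⟨ +-comm (j * (n ∸ 1)) j ⟩
      j + j * (n ∸ 1) ≡⟨ *-suc j (n ∸ 1) ⟨
      j * suc (n ∸ 1) ≡⟨ cong (j *_) (suc-pred n) ⟩
      j * n           ∎))
      where open ≡-Reasoning

  data Dir : Set where
    fw bw : Dir

  Walk : Dir → V → ℕ → V → Set
  Walk fw x j y = Fwd x j y
  Walk bw x j y = Fwd y j x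

  walk-exists : ∀ d x j → ∃[ y ] Walk d x j y
  walk-exists fw = fwd-exists
  walk-exists bw = fwd-ending-exists

  walk-trans : ∀ d {x i y j z} → Walk d x i y → Walk d y j z → Walk d x (i + j) z
  walk-trans fw s t = fwd-trans s t
  walk-trans bw {x} {i} {j = j} {z} s t = subst (λ e → Fwd z e x) (+-comm j i) (fwd-trans t s)

  walk-target-unique : ∀ d {x j y z} → Walk d x j y → Walk d x j z → y ≡ z
  walk-target-unique fw = fwd-target-unique
  walk-target-unique bw = fwd-source-unique

  walk-source-unique : ∀ d {y z j w} → Walk d y j w → Walk d z j w → y ≡ z
  walk-source-unique fw = fwd-source-unique
  walk-source-unique bw = fwd-target-unique

  walk-dist : ∀ d {x j y} → Walk d x j y → dist n x y ≤ j
  walk-dist fw s = fwd-dist s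
  walk-dist bw {x} {j} {y} s = subst (_≤ j) (dist-sym y x) (fwd-dist s)

  walk-zero : ∀ d {x y} → Walk d x 0 y → x ≡ y
  walk-zero fw s = fwd-zero s
  walk-zero bw s = sym (fwd-zero s)

  walk-loop : ∀ d {x j} → Walk d x j x → j ≡ 0 ⊎ n ≤ j
  walk-loop fw = fwd-loop
  walk-loop bw = fwd-loop

  walk-≢ : ∀ d {x j y} → Walk d x j y → 0 < j → j < n → x ≢ y
  walk-≢ d x→x j>0 j<n refl with walk-loop d x→x
  ... | inj₁ refl = <⇒≢ j>0 refl
  ... | inj₂ n≤j  = <⇒≱ j<n n≤j

  geodesic : ∀ x y → ∃[ d ] Walk d x (dist n x y) y
  geodesic x y with fwd-geodesic x y
  ... | inj₁ s = fw , s
  ... | inj₂ s = bw , s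

  walk-cancelˡ : ∀ d {x i y j z} → Walk d x i y → Walk d x (i + j) z → Walk d y j z
  walk-cancelˡ d {y = y} {j} s t = subst (Walk d y j)
    (walk-target-unique d (walk-trans d s (proj₂ (walk-exists d y j))) t) (proj₂ (walk-exists d y j))

  walk-cancelʳ : ∀ d {x i y j z} → Walk d x (i + j) z → Walk d y j z → Walk d x i y
  walk-cancelʳ d {x} {i} {y} {j} t s = subst (Walk d x i) y′≡y x→y′
    where
    y′ = proj₁ (walk-exists d x i)
    x→y′ = proj₂ (walk-exists d x i)
    y′→z′ = proj₂ (walk-exists d y′ j)
    y′≡y : y′ ≡ y
    y′≡y = walk-source-unique d
      (subst (Walk d y′ j) (walk-target-unique d (walk-trans d x→y′ y′→z′) t) y′→z′) s

  private
    meeting-dist : ∀ d {x p y z q} → Walk d x p y → Walk d z q y → dist n x z ≤ p + q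
    meeting-dist d {x} {p} {y} {z} {q} s t with ≤-total q p
    ... | inj₁ q≤p =
      ≤-trans (walk-dist d (walk-cancelʳ d (subst (λ e → Walk d x e y) (sym (m∸n+n≡m q≤p)) s) t))
              (≤-trans (m∸n≤m p q) (m≤m+n p q))
    ... | inj₂ p≤q = subst (_≤ p + q) (dist-sym z x)
      (≤-trans (walk-dist d (walk-cancelʳ d (subst (λ e → Walk d z e y) (sym (m∸n+n≡m p≤q)) t) s))
               (≤-trans (m∸n≤m q p) (m≤n+m q p)))

  dist-triangle : ∀ x y z → dist n x z ≤ dist n x y + dist n y z
  dist-triangle x y z with geodesic x y | geodesic y z
  ... | fw , s | fw , t = walk-dist fw (walk-trans fw s t)
  ... | bw , s | bw , t = walk-dist bw (walk-trans bw s t)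
  ... | fw , s | bw , t = meeting-dist fw s t
  ... | bw , s | fw , t = meeting-dist bw s t

  dist≡0⇒≡ : ∀ {x y} → dist n x y ≡ 0 → x ≡ y
  dist≡0⇒≡ {x} {y} e with geodesic x y
  ... | d , s = walk-zero d (subst (λ j → Walk d x j y) e s)

  ≢⇒dist>0 : ∀ {x y} → x ≢ y → 0 < dist n x y
  ≢⇒dist>0 x≢y = n≢0⇒n>0 (x≢y ∘′ dist≡0⇒≡)

  dist+dist≤n : ∀ x y → dist n x y + dist n x y ≤ n
  dist+dist≤n x y =
    ≤-trans (+-mono-≤ (m⊓n≤m D (n ∸ D)) (m⊓n≤n D (n ∸ D))) (≤-reflexive (m+[n∸m]≡n (gap≤n x y)))
    where D = ∣ toℕ x - toℕ y ∣

  dist>0⇒≢ : ∀ {x y} → 0 < dist n x y → x ≢ y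
  dist>0⇒≢ {x} d>0 refl = <⇒≢ d>0 (sym (dist-refl x))

  walk-length>0 : ∀ d {x j y} → x ≢ y → Walk d x j y → 0 < j
  walk-length>0 d x≢y s = <-≤-trans (≢⇒dist>0 x≢y) (walk-dist d s)

  geodesic-split : ∀ d {v a u j x} → Walk d v a u → dist n v u ≡ a → Walk d v j x → j ≤ a →
                   dist n v x ≡ j × Walk d x (a ∸ j) u
  geodesic-split d {v} {a} {u} {j} {x} v→u d≡a v→x j≤a = ≤-antisym (walk-dist d v→x) j≤d , x→u
    where
    x→u : Walk d x (a ∸ j) u
    x→u = walk-cancelˡ d v→x (subst (λ e → Walk d v e u) (sym (m+[n∸m]≡n j≤a)) v→u)
    j≤d : j ≤ dist n v x
    j≤d = +-cancelʳ-≤ (a ∸ j) j (dist n v x) (begin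
      j + (a ∸ j)              ≡⟨ m+[n∸m]≡n j≤a ⟩
      a                        ≡⟨ d≡a ⟨
      dist n v u               ≤⟨ dist-triangle v x u ⟩
      dist n v x + dist n x u  ≤⟨ +-monoʳ-≤ (dist n v x) (walk-dist d x→u) ⟩
      dist n v x + (a ∸ j)     ∎)
      where open ≤-Reasoning

  dist-offset : ∀ x y e e′ → toℕ y + e ≡ toℕ x → n ≡ e + e′ → dist n x y ≡ e ⊓ e′
  dist-offset x y e e′ y+e≡x n≡ =
    cong₂ _⊓_ D≡e (trans (cong (_∸ D) n≡) (trans (cong (e + e′ ∸_) D≡e) (m+n∸m≡n e e′)))
    where
    D = ∣ toℕ x - toℕ y ∣
    D≡e : D ≡ e
    D≡e = begin
      ∣ toℕ x - toℕ y ∣     ≡⟨ cong ∣_- toℕ y ∣ y+e≡x ⟨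
      ∣ toℕ y + e - toℕ y ∣ ≡⟨ ∣-∣-comm (toℕ y + e) (toℕ y) ⟩
      ∣ toℕ y - toℕ y + e ∣ ≡⟨ ∣m-m+n∣≡n (toℕ y) e ⟩
      e                     ∎
      where open ≡-Reasoning

  neighbour : Dir → V → V
  neighbour d v = proj₁ (walk-exists d v 1)

  neighbour-walk : ∀ d v → Walk d v 1 (neighbour d v)
  neighbour-walk d v = proj₂ (walk-exists d v 1)

  neighbours-distinct : 3 ≤ n → ∀ s → neighbour bw s ≢ neighbour fw s
  neighbours-distinct 3≤n s = walk-≢ fw (walk-trans fw (neighbour-walk bw s) (neighbour-walk fw s)) (s≤s z≤n) 3≤n

  arc : Dir → V → ℕ → List V
  arc d v zero    = []
  arc d v (suc m) = proj₁ (walk-exists d v (suc m)) ∷ arc d v m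

  length-arc : ∀ d v m → length (arc d v m) ≡ m
  length-arc d v zero    = refl
  length-arc d v (suc m) = cong suc (length-arc d v m)

  ∈-arc⁻ : ∀ d v m {x} → x ∈ arc d v m → ∃[ j ] (0 < j × j ≤ m × Walk d v j x)
  ∈-arc⁻ d v (suc m) (here refl) = suc m , s≤s z≤n , ≤-refl , proj₂ (walk-exists d v (suc m))
  ∈-arc⁻ d v (suc m) (there x∈) =
    let (j , j>0 , j≤m , v→x) = ∈-arc⁻ d v m x∈ in j , j>0 , m≤n⇒m≤1+n j≤m , v→x

  arc-unique : ∀ d v m → (∀ {j x} → 0 < j → j ≤ m → Walk d v j x → dist n v x ≡ j) → Unique (arc d v m)
  arc-unique d v zero    _      = []
  arc-unique d v (suc m) dist≡ =
    All.tabulate last≢ ∷ arc-unique d v m (λ j>0 j≤m → dist≡ j>0 (m≤n⇒m≤1+n j≤m))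
    where
    last≢ : ∀ {x} → x ∈ arc d v m → proj₁ (walk-exists d v (suc m)) ≢ x
    last≢ x∈ refl with ∈-arc⁻ d v m x∈
    ... | j , j>0 , j≤m , v→x = <⇒≢ (s≤s j≤m) (begin
      j          ≡⟨ dist≡ j>0 (m≤n⇒m≤1+n j≤m) v→x ⟨
      dist n v _ ≡⟨ dist≡ (s≤s z≤n) ≤-refl (proj₂ (walk-exists d v (suc m))) ⟩
      suc m      ∎)
      where open ≡-Reasoning

  -- Costs

  δ : V → ℕ → V → ℕ
  δ c r v with v ≟ᶠ c
  ... | yes _ = r
  ... | no  _ = 0

  δ-at : ∀ c r → δ c r c ≡ r
  δ-at c r with c ≟ᶠ c
  ... | yes _  = refl
  ... | no c≢c = ⊥-elim (c≢c refl)

  δ-off : ∀ {c v} r → v ≢ c → δ c r v ≡ 0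
  δ-off {c} {v} r v≢c with v ≟ᶠ c
  ... | yes v≡c = ⊥-elim (v≢c v≡c)
  ... | no  _   = refl

  private
    sum-δ-∉ : ∀ {c} r xs → c ∉ xs → sum (map (δ c r) xs) ≡ 0
    sum-δ-∉ r []       _   = refl
    sum-δ-∉ r (x ∷ xs) c∉ =
      cong₂ _+_ (δ-off r (λ x≡c → c∉ (here (sym x≡c)))) (sum-δ-∉ r xs (c∉ ∘′ there))

    sum-δ-∈ : ∀ {c} r xs → Unique xs → c ∈ xs → sum (map (δ c r) xs) ≡ r
    sum-δ-∈ {c} r (c ∷ xs) (c∉ ∷ _) (here refl) =
      trans (cong₂ _+_ (δ-at c r) (sum-δ-∉ r xs (λ c∈ → All.lookup c∉ c∈ refl))) (+-identityʳ r)
    sum-δ-∈ r (x ∷ xs) (x∉ ∷ u) (there c∈) =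
      cong₂ _+_ (δ-off r (λ x≡c → All.lookup x∉ c∈ x≡c)) (sum-δ-∈ r xs u c∈)

  cost-δ : ∀ c r → cost n (δ c r) ≡ r
  cost-δ c r = sum-δ-∈ r (allFin n) (allFin⁺ n) (∈-allFin c)

  cost-+ : ∀ f g → cost n (λ v → f v + g v) ≡ cost n f + cost n g
  cost-+ f g = sum-map-+ f g (allFin n)

  cost-mono : ∀ {f g} → (∀ v → f v ≤ g v) → cost n f ≤ cost n g
  cost-mono f≤g = sum-map-mono f≤g (allFin n)

  cost≤-single : ∀ f v → (∀ w → w ≢ v → f w ≡ 0) → cost n f ≤ f v
  cost≤-single f v vanish = ≤-trans (cost-mono below) (≤-reflexive (cost-δ v (f v)))
    where
    below : ∀ w → f w ≤ δ v (f v) w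
    below w with w ≟ᶠ v
    ... | yes refl = ≤-refl
    ... | no  w≢v  = ≤-reflexive (vanish w w≢v)

  cost≤-pair : ∀ f v v′ → (∀ w → w ≢ v → w ≢ v′ → f w ≡ 0) → cost n f ≤ f v + f v′
  cost≤-pair f v v′ vanish = begin
    cost n f                                   ≤⟨ cost-mono below ⟩
    cost n (λ w → δ v (f v) w + δ v′ (f v′) w) ≡⟨ cost-+ (δ v (f v)) (δ v′ (f v′)) ⟩
    cost n (δ v (f v)) + cost n (δ v′ (f v′))  ≡⟨ cong₂ _+_ (cost-δ v (f v)) (cost-δ v′ (f v′)) ⟩
    f v + f v′                                 ∎
    where
    open ≤-Reasoning
    below : ∀ w → f w ≤ δ v (f v) w + δ v′ (f v′) w
    below w with w ≟ᶠ v | w ≟ᶠ v′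
    ... | yes refl | _        = m≤m+n (f w) _
    ... | no  _    | yes refl = m≤n+m (f w) _
    ... | no  w≢v  | no  w≢v′ = ≤-trans (≤-reflexive (vanish w w≢v w≢v′)) z≤n

  -- Private neighbourhoods and blocks

  module _ (f : V → ℕ) where

    InH? : ∀ u v → Dec (InH n f u v)
    InH? u v = (0 <? f v) ×-dec (dist n u v ≤? f v)

    InPN? : ∀ v u → Dec (InPN n f v u)
    InPN? v u = all? (λ w → InH? u w ⇔-dec (w ≟ᶠ v))

    PBSpecial? : ∀ v → Dec (PBSpecial n f v)
    PBSpecial? v = (f v ≟ 1) ×-dec all? (λ u → InPN? v u ⇔-dec (u ≟ᶠ v))

    pn-hears-only : ∀ {v} u {w} → InPN n f v u → InH n f u w → w ≡ v
    pn-hears-only u pn h = Equivalence.to (pn _) h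

    special-positive : ∀ {s} → PBSpecial n f s → 0 < f s
    special-positive (f≡1 , _) = ≤-reflexive (sym f≡1)

    special-hears-only : ∀ {s w} → PBSpecial n f s → InH n f s w → w ≡ s
    special-hears-only {s} (_ , PN≡s) = pn-hears-only s (Equivalence.from (PN≡s s) refl)

    -- A witness of PB_f(v) ≠ ∅ outside the special case.
    record Boundary (v : V) : Set where
      field
        point      : V
        point∈PN   : InPN n f v point
        point-dist : dist n point v ≡ f v
        positive   : 0 < f v

    open Boundary

    boundary-dir : ∀ {v} → Boundary v → Dir
    boundary-dir {v} b = proj₁ (geodesic v (point b))

    boundary-dist : ∀ {v} (b : Boundary v) → dist n v (point b) ≡ f v
    boundary-dist {v} b = trans (dist-sym v (point b)) (point-dist b)

    boundary-walk : ∀ {v} (b : Boundary v) → Walk (boundary-dir b) v (f v) (point b)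
    boundary-walk {v} b =
      subst (λ j → Walk (boundary-dir b) v j (point b)) (boundary-dist b) (proj₂ (geodesic v (point b)))

    special-no-boundary : ∀ {v} → PBSpecial n f v → ¬ Boundary v
    special-no-boundary {v} (f≡1 , PN≡v) b = 0≢1+n (begin
      0                  ≡⟨ dist-refl v ⟨
      dist n v v         ≡⟨ cong (λ x → dist n x v) (Equivalence.to (PN≡v (point b)) (point∈PN b)) ⟨
      dist n (point b) v ≡⟨ point-dist b ⟩
      f v                ≡⟨ f≡1 ⟩
      1                  ∎)
      where open ≡-Reasoning

    data Role (v : V) : Set where
      silent  : f v ≡ 0 → Role v
      special : PBSpecial n f v → Role v
      bounded : Boundary v → Role v

    between-silent : ∀ {v w} (b : Boundary v) → Role w → 0 < f w → 0 < dist n v w →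
                     dist n v w + dist n w (point b) ≤ f v → ⊥
    between-silent b (silent f≡0) f>0 _ _ = <⇒≢ f>0 (sym f≡0)
    between-silent {v} {w} b (special sp) _ d>0 d+d≤f =
      dist>0⇒≢ d>0 (special-hears-only sp (positive b , subst (_≤ f v) (dist-sym v w) (m+n≤o⇒m≤o _ d+d≤f)))
    between-silent {v} {w} b (bounded b′) f>0 d>0 d+d≤f with dist n (point b) w ≤? f w
    ... | yes u-hears-w = dist>0⇒≢ d>0 (sym (pn-hears-only (point b) (point∈PN b) (f>0 , u-hears-w)))
    ... | no  u-deaf    = dist>0⇒≢ d>0 (pn-hears-only (point b′) (point∈PN b′) (positive b , u′-hears-v))
      where
      w-short : f w < dist n w (point b)
      w-short = subst (f w <_) (dist-sym (point b) w) (≰⇒> u-deaf)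
      u′-hears-v : dist n (point b′) v ≤ f v
      u′-hears-v = begin
        dist n (point b′) v              ≡⟨ dist-sym (point b′) v ⟩
        dist n v (point b′)              ≤⟨ dist-triangle v w (point b′) ⟩
        dist n v w + dist n w (point b′) ≡⟨ cong (dist n v w +_) (boundary-dist b′) ⟩
        dist n v w + f w                 ≤⟨ +-monoʳ-≤ (dist n v w) (<⇒≤ w-short) ⟩
        dist n v w + dist n w (point b)  ≤⟨ d+d≤f ⟩
        f v                              ∎
        where open ≤-Reasoning

    arc-silent : ∀ d {v z j} (b : Boundary v) → Walk d v (f v) (point b) → Role z → 0 < f z →
                 Walk d v j z → 0 < j → j ≤ f v → ⊥
    arc-silent d {v} {z} {j} b v→u role f>0 v→z j>0 j≤f with geodesic-split d v→u (boundary-dist b) v→z j≤f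
    ... | d≡j , z→u = between-silent b role f>0 (subst (0 <_) (sym d≡j) j>0) (begin
      dist n v z + dist n z (point b) ≤⟨ +-mono-≤ (≤-reflexive d≡j) (walk-dist d z→u) ⟩
      j + (f v ∸ j)                   ≡⟨ m+[n∸m]≡n j≤f ⟩
      f v                             ∎)
      where open ≤-Reasoning

    on-arc-silent : ∀ {v z} (b : Boundary v) → Role z → 0 < f z → z ∈ arc (boundary-dir b) v (f v) → ⊥
    on-arc-silent {v} b role f>0 z∈ with ∈-arc⁻ (boundary-dir b) v (f v) z∈
    ... | j , j>0 , j≤f , v→z = arc-silent (boundary-dir b) b (boundary-walk b) role f>0 v→z j>0 j≤f

    private
      arcs-meet-same-dir : ∀ d {v w x j k} (b : Boundary v) (b′ : Boundary w) →
                           Walk d v (f v) (point b) → Walk d w (f w) (point b′) → v ≢ w →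
                           Walk d v j x → Walk d w k x → j ≤ f v → k ≤ f w → ⊥
      arcs-meet-same-dir d {v} {w} {x} {j} {k} b b′ v→u w→u′ v≢w v→x w→x j≤f k≤f with ≤-total k j
      ... | inj₁ k≤j = arc-silent d b v→u (bounded b′) (positive b′) v→w (walk-length>0 d v≢w v→w)
                         (≤-trans (m∸n≤m j k) j≤f)
        where
        v→w : Walk d v (j ∸ k) w
        v→w = walk-cancelʳ d (subst (λ e → Walk d v e x) (sym (m∸n+n≡m k≤j)) v→x) w→x
      ... | inj₂ j≤k = arc-silent d b′ w→u′ (bounded b) (positive b) w→v (walk-length>0 d (v≢w ∘′ sym) w→v)
                         (≤-trans (m∸n≤m k j) k≤f)
        where
        w→v : Walk d w (k ∸ j) v
        w→v = walk-cancelʳ d (subst (λ e → Walk d w e x) (sym (m∸n+n≡m j≤k)) w→x) v→x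

      arcs-meet-opposite-dir : ∀ d {v w x j k} (b : Boundary v) (b′ : Boundary w) →
                               Walk d v (f v) (point b) → v ≢ w →
                               Walk d v j x → Walk d x k w → j ≤ f v → k ≤ f w → ⊥
      arcs-meet-opposite-dir d {v} {w} {x} {j} {k} b b′ v→u v≢w v→x x→w j≤f k≤f
        with geodesic-split d v→u (boundary-dist b) v→x j≤f
      ... | _ , x→u with k ≤? f v ∸ j
      ...   | yes k≤ = arc-silent d b v→u (bounded b′) (positive b′) (walk-trans d v→x x→w)
                         (walk-length>0 d v≢w (walk-trans d v→x x→w))
                         (≤-trans (+-monoʳ-≤ j k≤) (≤-reflexive (m+[n∸m]≡n j≤f)))
      ...   | no  k≰ = v≢w (sym (pn-hears-only (point b) (point∈PN b) (positive b′ ,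
                         ≤-trans (walk-dist d u→w) (≤-trans (m∸n≤m k (f v ∸ j)) k≤f))))
        where
        u→w : Walk d (point b) (k ∸ (f v ∸ j)) w
        u→w = walk-cancelˡ d x→u (subst (λ e → Walk d x e w) (sym (m+[n∸m]≡n (<⇒≤ (≰⇒> k≰)))) x→w)

    arcs-disjoint : ∀ {v w x} (b : Boundary v) (b′ : Boundary w) → v ≢ w →
                    x ∈ arc (boundary-dir b) v (f v) → x ∈ arc (boundary-dir b′) w (f w) → ⊥
    arcs-disjoint {v} {w} {x} b b′ v≢w x∈ x∈′ with ∈-arc⁻ _ v (f v) x∈ | ∈-arc⁻ _ w (f w) x∈′
    ... | j , _ , j≤f , v→x | k , _ , k≤f , w→x =
      meet (boundary-dir b) (boundary-dir b′) (boundary-walk b) (boundary-walk b′) v→x w→x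
      where
      meet : ∀ d e → Walk d v (f v) (point b) → Walk e w (f w) (point b′) →
             Walk d v j x → Walk e w k x → ⊥
      meet fw fw v→u w→u′ v→x w→x = arcs-meet-same-dir fw b b′ v→u w→u′ v≢w v→x w→x j≤f k≤f
      meet bw bw v→u w→u′ v→x w→x = arcs-meet-same-dir bw b b′ v→u w→u′ v≢w v→x w→x j≤f k≤f
      meet fw bw v→u _    v→x w→x = arcs-meet-opposite-dir fw b b′ v→u v≢w v→x w→x j≤f k≤f
      meet bw fw v→u _    v→x w→x = arcs-meet-opposite-dir bw b b′ v→u v≢w v→x w→x j≤f k≤f

    block : ∀ v → Role v → List V
    block v (silent _)  = []
    block v (special _) = v ∷ []
    block v (bounded b) = arc (boundary-dir b) v (f v)

    length-block : ∀ v r → length (block v r) ≡ f v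
    length-block v (silent f≡0)       = sym f≡0
    length-block v (special (f≡1 , _)) = sym f≡1
    length-block v (bounded b)        = length-arc (boundary-dir b) v (f v)

    block-unique : ∀ v r → Unique (block v r)
    block-unique v (silent _)  = []
    block-unique v (special _) = All.[] ∷ []
    block-unique v (bounded b) = arc-unique (boundary-dir b) v (f v)
      (λ _ j≤f v→x → proj₁ (geodesic-split (boundary-dir b) (boundary-walk b) (boundary-dist b) v→x j≤f))

    blocks-disjoint : ∀ {v w} r r′ → v ≢ w → Disjoint (block v r) (block w r′)
    blocks-disjoint (special _)  (special _)  v≢w (here refl , here refl) = v≢w refl
    blocks-disjoint (special sp) (bounded b′) v≢w (here refl , x∈′)       =
      on-arc-silent b′ (special sp) (special-positive sp) x∈′
    blocks-disjoint (bounded b)  (special sp) v≢w (x∈ , here refl)        =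
      on-arc-silent b (special sp) (special-positive sp) x∈
    blocks-disjoint (bounded b)  (bounded b′) v≢w (x∈ , x∈′)              = arcs-disjoint b b′ v≢w x∈ x∈′

    Uncovered : V → Set
    Uncovered x = ∀ w (r : Role w) → x ∉ block w r

    bounded-uncovered : ∀ {z} → Boundary z → Uncovered z
    bounded-uncovered b w (special sp) (here refl) = special-no-boundary sp b
    bounded-uncovered b w (bounded b′) z∈          = on-arc-silent b′ (bounded b) (positive b) z∈

    special-neighbour-silent : 2 ≤ n → ∀ d {s y} → PBSpecial n f s → Walk d s 1 y → ¬ (0 < f y)
    special-neighbour-silent 2≤n d sp s→y f>0 =
      walk-≢ d s→y (s≤s z≤n) 2≤n (sym (special-hears-only sp (f>0 , ≤-trans (walk-dist d s→y) f>0)))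

    special-neighbour-uncovered : 2 ≤ n → ∀ d {s y} → PBSpecial n f s → Walk d s 1 y → Uncovered y
    special-neighbour-uncovered 2≤n d sp s→y w (special sp′) (here refl) =
      special-neighbour-silent 2≤n d sp s→y (special-positive sp′)
    special-neighbour-uncovered 2≤n d {s} {y} sp@(f≡1 , _) s→y w (bounded b) y∈
      with ∈-arc⁻ (boundary-dir b) w (f w) y∈
    ... | j , j>0 , j≤f , w→y = meet d (boundary-dir b) s→y (boundary-walk b) w→y
      where
      s≢w : s ≢ w
      s≢w refl = special-no-boundary sp b
      -- s is one step before y on the arc of w, hence inside w's ball
      behind : ∀ e → Walk e s 1 y → Walk e w j y → ⊥
      behind e s→y w→y = s≢w (sym (special-hears-only sp (positive b ,
        subst (_≤ f w) (dist-sym w s) (≤-trans (walk-dist e w→s) (≤-trans (m∸n≤m j 1) j≤f)))))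
        where
        w→s : Walk e w (j ∸ 1) s
        w→s = walk-cancelʳ e (subst (λ i → Walk e w i y) (sym (m∸n+n≡m j>0)) w→y) s→y
      -- s is one step beyond y: either still inside w's ball, or y is w's boundary point and hears s
      beyond : ∀ e → Walk e y 1 s → Walk e w (f w) (point b) → Walk e w j y → ⊥
      beyond e y→s w→u w→y with j <? f w
      ... | yes j<f = s≢w (sym (special-hears-only sp (positive b , subst (_≤ f w) (dist-sym w s)
        (≤-trans (walk-dist e (walk-trans e w→y y→s)) (≤-trans (≤-reflexive (+-comm j 1)) j<f)))))
      ... | no  j≮f = s≢w (pn-hears-only (point b) (point∈PN b) (special-positive sp ,
        subst (λ x → dist n x s ≤ f s) (walk-target-unique e w→y′ w→u)
          (≤-trans (walk-dist e y→s) (≤-reflexive (sym f≡1)))))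
        where
        w→y′ : Walk e w (f w) y
        w→y′ = subst (λ i → Walk e w i y) (≤-antisym j≤f (≮⇒≥ j≮f)) w→y
      meet : ∀ d e → Walk d s 1 y → Walk e w (f w) (point b) → Walk e w j y → ⊥
      meet fw fw s→y _   w→y = behind fw s→y w→y
      meet bw bw s→y _   w→y = behind bw s→y w→y
      meet fw bw s→y w→u w→y = beyond bw s→y w→u w→y
      meet bw fw s→y w→u w→y = beyond fw s→y w→u w→y

    lower : V → V → ℕ
    lower v w = f w ∸ δ v 1 w

    lower-off : ∀ {v w} → w ≢ v → lower v w ≡ f w
    lower-off w≢v = cong (f _ ∸_) (δ-off 1 w≢v)

    lower-at : ∀ v → lower v v ≡ f v ∸ 1
    lower-at v = cong (f v ∸_) (δ-at v 1)

    lower-≤ : ∀ v w → lower v w ≤ f w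
    lower-≤ v w = m∸n≤m (f w) (δ v 1 w)

    -- A vertex hearing only v must be in PN(v) strictly inside v's ball, so v can broadcast one less.
    lower-dominating : ∀ {v} → IsDominating n f → 0 < f v → ¬ PBSpecial n f v →
                       ¬ (∃[ u ] (InPN n f v u × dist n u v ≡ f v)) → IsDominating n (lower v)
    lower-dominating {v} dom f>0 nonspecial noBoundary y with any? (λ w → InH? y w ×-dec ¬? (w ≟ᶠ v))
    ... | yes (w , (f>0 , d≤) , w≢v) = w , subst (0 <_) (sym (lower-off w≢v)) f>0
                                         , subst (dist n y w ≤_) (sym (lower-off w≢v)) d≤
    ... | no onlyV = v , subst (0 <_) (sym (lower-at v)) (∸-monoˡ-< f>1 (s≤s z≤n))
                       , subst (dist n y v ≤_) (sym (lower-at v)) (<⇒≤pred d<f)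
      where
      hears-only-v : ∀ w → InH n f y w → w ≡ v
      hears-only-v w h with w ≟ᶠ v
      ... | yes w≡v = w≡v
      ... | no  w≢v = ⊥-elim (onlyV (w , h , w≢v))
      y-hears-v : InH n f y v
      y-hears-v = let (w , h) = dom y in subst (InH n f y) (hears-only-v w h) h
      y∈PN : InPN n f v y
      y∈PN w = mk⇔ (hears-only-v w) (λ { refl → y-hears-v })
      d<f : dist n y v < f v
      d<f = ≤∧≢⇒< (proj₂ y-hears-v) (λ d≡f → noBoundary (y , y∈PN , d≡f))
      f>1 : 1 < f v
      f>1 with f v ≟ 1
      ... | no  f≢1 = ≤∧≢⇒< f>0 (f≢1 ∘′ sym)
      ... | yes f≡1 =
        ⊥-elim (nonspecial (f≡1 , λ u → mk⇔ (PN-only-v u) (λ { refl → subst (InPN n f v) y≡v y∈PN })))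
        where
        y≡v : y ≡ v
        y≡v = dist≡0⇒≡ (n≤0⇒n≡0 (<⇒≤pred (subst (dist n y v <_) f≡1 d<f)))
        PN-only-v : ∀ u → InPN n f v u → u ≡ v
        PN-only-v u u∈PN with u ≟ᶠ v
        ... | yes u≡v = u≡v
        ... | no  u≢v = ⊥-elim (noBoundary (u , u∈PN , ≤-antisym
                (proj₂ (Equivalence.from (u∈PN v) refl)) (subst (_≤ dist n u v) (sym f≡1) (≢⇒dist>0 u≢v))))

  minimalDominating⇒irredundant : ∀ {f} → IsMinimalDominating n f → IsIrredundant n f
  minimalDominating⇒irredundant {f} (bc , dom , minimal) = bc , boundary
    where
    boundary : ∀ v → 0 < f v → ∃[ u ] InPB n f v u
    boundary v f>0 with PBSpecial? f v
    ... | yes sp = v , inj₁ (sp , refl)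
    ... | no nonspecial with any? (λ u → InPN? f v u ×-dec (dist n u v ≟ f v))
    ...   | yes (u , pb) = u , inj₂ (nonspecial , pb)
    ...   | no noBoundary = ⊥-elim (<⇒≢ (∸-monoˡ-< (n<1+n _) f>0) (trans (sym (lower-at f v)) lowered≡f))
      where
      lowered≡f : lower f v v ≡ f v
      lowered≡f = minimal (lower f v)
        (λ w → let (u , le) = bc w in u , ≤-trans (lower-≤ f v w) le)
        (lower-dominating f dom f>0 nonspecial noBoundary) (lower-≤ f v) v

  -- Upper bounds for irredundant broadcasts

  module _ {f : V → ℕ} (irr : IsIrredundant n f) where

    role : ∀ v → Role f v
    role v with 0 <? f v
    ... | no  f≯0 = silent (n≤0⇒n≡0 (≮⇒≥ f≯0))
    ... | yes f>0 with proj₂ irr v f>0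
    ...   | _ , inj₁ (sp , _)           = special sp
    ...   | u , inj₂ (_ , u∈PN , d≡f) =
      bounded (record { point = u ; point∈PN = u∈PN ; point-dist = d≡f ; positive = f>0 })

    blocks : List V
    blocks = concat (map (λ v → block f v (role v)) (allFin n))

    length-blocks : length blocks ≡ cost n f
    length-blocks = trans (length-concat-map (λ v → block f v (role v)) (allFin n))
                          (cong sum (map-cong (λ v → length-block f v (role v)) (allFin n)))

    blocks-unique : Unique blocks
    blocks-unique = concat⁺ (map⁺ (All.tabulate (λ {v} _ → block-unique f v (role v))))
                            (AllPairs.map⁺ (AllPairs.map (blocks-disjoint f (role _) (role _)) (allFin⁺ n)))

    uncovered-bound : ∀ E → Unique E → All (Uncovered f) E → cost n f ≤ n ∸ length E
    uncovered-bound E E-unique uncovered = m+n≤o⇒m≤o∸n (cost n f) (begin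
      cost n f + length E      ≡⟨ cong (_+ length E) length-blocks ⟨
      length blocks + length E ≡⟨ length-++ blocks ⟨
      length (blocks ++ E)     ≤⟨ unique-length≤ (++⁺ blocks-unique E-unique disjoint) ⟩
      n                        ∎)
      where
      open ≤-Reasoning
      disjoint : Disjoint blocks E
      disjoint (x∈blocks , x∈E) =
        let (w , x∈block) = satisfied (map⁻ {f = λ v → block f v (role v)} {xs = allFin n}
                                            (∈-concat⁻ _ x∈blocks))
        in All.lookup uncovered x∈E w (role w) x∈block

    open Boundary

    bounded-of : ∀ {v} → ¬ PBSpecial n f v → 0 < f v → Boundary f v
    bounded-of {v} nonspecial f>0 with role v
    ... | silent f≡0 = ⊥-elim (<⇒≢ f>0 (sym f≡0))
    ... | special sp = ⊥-elim (nonspecial sp)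
    ... | bounded b  = b

    broadcast-half : ∀ v → f v + f v ≤ n
    broadcast-half v = let (u , f≤d) = proj₁ irr v in ≤-trans (+-mono-≤ f≤d f≤d) (dist+dist≤n v u)

    other-broadcast-short : ∀ {v w} → v ≢ w → 0 < f v → Boundary f w → suc (f v) + suc (f v) ≤ n
    other-broadcast-short {v} v≢w f>0 b with dist n (point b) v ≤? f v
    ... | yes u-hears-v = ⊥-elim (v≢w (pn-hears-only f (point b) (point∈PN b) (f>0 , u-hears-v)))
    ... | no  u-deaf    = ≤-trans (+-mono-≤ (≰⇒> u-deaf) (≰⇒> u-deaf)) (dist+dist≤n (point b) v)

    single-or-pair : (∃[ v ] (∀ w → w ≢ v → f w ≡ 0)) ⊎ (∃[ v ] ∃[ w ] (v ≢ w × 0 < f v × 0 < f w))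
    single-or-pair with any? (λ v → 0 <? f v)
    ... | no none = inj₁ (fromℕ< (>-nonZero⁻¹ n) , λ w _ → n≤0⇒n≡0 (≮⇒≥ (λ f>0 → none (w , f>0))))
    ... | yes (v , f>0) with any? (λ w → ¬? (w ≟ᶠ v) ×-dec (0 <? f w))
    ...   | no alone = inj₁ (v , λ w w≢v → n≤0⇒n≡0 (≮⇒≥ (λ f>0 → alone (w , w≢v , f>0))))
    ...   | yes (w , w≢v , f>0′) = inj₂ (v , w , w≢v ∘′ sym , f>0 , f>0′)

    nonspecial-uncovered : ¬ ∃ (PBSpecial n f) → ∀ {v} → 0 < f v → Uncovered f v
    nonspecial-uncovered nospecial {v} f>0 = bounded-uncovered f (bounded-of (nospecial ∘′ (v ,_)) f>0)

    special⇒cost≤n∸2 : 3 ≤ n → ∀ {s} → PBSpecial n f s → cost n f ≤ n ∸ 2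
    special⇒cost≤n∸2 3≤n {s} sp = uncovered-bound (neighbour bw s ∷ neighbour fw s ∷ [])
      ((neighbours-distinct 3≤n s All.∷ All.[]) ∷ All.[] ∷ [])
      (special-neighbour-uncovered f 2≤n bw sp (neighbour-walk bw s) All.∷
       special-neighbour-uncovered f 2≤n fw sp (neighbour-walk fw s) All.∷ All.[])
      where 2≤n = ≤-trans (n≤1+n 2) 3≤n

    irredundant-cost≤n∸2 : 3 ≤ n → cost n f ≤ n ∸ 2
    irredundant-cost≤n∸2 3≤n with any? (PBSpecial? f)
    ... | yes (s , sp) = special⇒cost≤n∸2 3≤n sp
    ... | no nospecial with single-or-pair
    ...   | inj₁ (v , vanish) = ≤-trans (cost≤-single f v vanish) (half-≤∸2 3≤n (broadcast-half v))
    ...   | inj₂ (v , w , v≢w , f>0 , f>0′) = uncovered-bound (v ∷ w ∷ []) ((v≢w All.∷ All.[]) ∷ All.[] ∷ [])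
            (nonspecial-uncovered nospecial f>0 All.∷ nonspecial-uncovered nospecial f>0′ All.∷ All.[])

    private
      ThirdUncovered : V → Set
      ThirdUncovered s = ∃[ z ] (Uncovered f z × neighbour bw s ≢ z × neighbour fw s ≢ z)

      special-after-neighbour : 5 ≤ n → ∀ {s w} → PBSpecial n f s → PBSpecial n f w →
                                Walk fw (neighbour fw s) 1 w → ThirdUncovered s
      special-after-neighbour 5≤n {s} {w} sp sp′ y→w = neighbour fw w
        , special-neighbour-uncovered f (≤-trans (m≤n+m 2 3) 5≤n) fw sp′ (neighbour-walk fw w)
        , walk-≢ fw (walk-trans fw (walk-trans fw (neighbour-walk bw s) (neighbour-walk fw s)) y→z) (s≤s z≤n) 5≤n
        , walk-≢ fw y→z (s≤s z≤n) (≤-trans (m≤n+m 3 2) 5≤n)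
        where
        y→z : Walk fw (neighbour fw s) 2 (neighbour fw w)
        y→z = walk-trans fw y→w (neighbour-walk fw w)

    -- The right neighbour y of s is not private to s, so another broadcaster w hears y: either w has a
    -- boundary private neighbour, or w is special and sits just after y, and then its own right neighbour is free.
    special-third-uncovered : 5 ≤ n → ∀ {s} → PBSpecial n f s → ThirdUncovered s
    special-third-uncovered 5≤n {s} sp = third (any? (λ w → InH? f y w ×-dec ¬? (w ≟ᶠ s)))
      where
      y = neighbour fw s
      2≤n : 2 ≤ n
      2≤n = ≤-trans (m≤n+m 2 3) 5≤n

      third : Dec (∃[ w ] (InH n f y w × w ≢ s)) → ThirdUncovered s
      third (no only-s) = ⊥-elim (walk-≢ fw (neighbour-walk fw s) (s≤s z≤n) 2≤n
                            (sym (Equivalence.to (proj₂ sp y) y∈PN)))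
        where
        hears-only-s : ∀ w → InH n f y w → w ≡ s
        hears-only-s w h with w ≟ᶠ s
        ... | yes w≡s = w≡s
        ... | no  w≢s = ⊥-elim (only-s (w , h , w≢s))
        y∈PN : InPN n f s y
        y∈PN w = mk⇔ (hears-only-s w) λ { refl → special-positive f sp ,
          ≤-trans (subst (_≤ 1) (dist-sym s y) (walk-dist fw (neighbour-walk fw s))) (special-positive f sp) }
      third (yes (w , (f>0 , d≤f) , w≢s)) with role w
      ... | silent f≡0 = ⊥-elim (<⇒≢ f>0 (sym f≡0))
      ... | bounded b  = w , bounded-uncovered f b , neighbour≢ bw , neighbour≢ fw
        where
        neighbour≢ : ∀ d → neighbour d s ≢ w
        neighbour≢ d refl = special-neighbour-silent f 2≤n d sp (neighbour-walk d s) f>0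
      ... | special sp′@(f≡1 , _) = next (geodesic y w)
        where
        d≡1 : dist n y w ≡ 1
        d≡1 = ≤-antisym (subst (_ ≤_) f≡1 d≤f)
                (≢⇒dist>0 {y} {w} λ { refl → special-neighbour-silent f 2≤n fw sp (neighbour-walk fw s) f>0 })
        next : ∃[ d ] Walk d y (dist n y w) w → ThirdUncovered s
        next (bw , y→w) =
          ⊥-elim (w≢s (fwd-source-unique (subst (λ j → Walk bw y j w) d≡1 y→w) (neighbour-walk fw s)))
        next (fw , y→w) = special-after-neighbour 5≤n sp sp′ (subst (λ j → Walk fw y j w) d≡1 y→w)

    special⇒cost≤n∸3 : 5 ≤ n → ∀ {s} → PBSpecial n f s → cost n f ≤ n ∸ 3
    special⇒cost≤n∸3 5≤n {s} sp = let (z , z-uncovered , bw≢z , fw≢z) = special-third-uncovered 5≤n sp in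
      uncovered-bound (neighbour bw s ∷ neighbour fw s ∷ z ∷ [])
        ((neighbours-distinct 3≤n s All.∷ bw≢z All.∷ All.[]) ∷ (fw≢z All.∷ All.[]) ∷ All.[] ∷ [])
        (special-neighbour-uncovered f 2≤n bw sp (neighbour-walk bw s) All.∷
         special-neighbour-uncovered f 2≤n fw sp (neighbour-walk fw s) All.∷ z-uncovered All.∷ All.[])
      where
      3≤n = ≤-trans (m≤n+m 3 2) 5≤n
      2≤n = ≤-trans (m≤n+m 2 3) 5≤n

    irredundant-cost≤n∸3 : ∀ m → n ≡ 5 + (m + m) → cost n f ≤ n ∸ 3
    irredundant-cost≤n∸3 m n≡ with any? (PBSpecial? f)
    ... | yes (s , sp) = special⇒cost≤n∸3 (subst (5 ≤_) (sym n≡) (m≤m+n 5 (m + m))) sp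
    ... | no nospecial with single-or-pair
    ...   | inj₁ (v , vanish) = ≤-trans (cost≤-single f v vanish) (subst (f v ≤_) (cong (_∸ 3) (sym n≡))
                                  (odd-lone-≤ m (subst (f v + f v ≤_) n≡ (broadcast-half v))))
    ...   | inj₂ (v , w , v≢w , f>0 , f>0′) with any? (λ z → ¬? (z ≟ᶠ v) ×-dec ¬? (z ≟ᶠ w) ×-dec (0 <? f z))
    ...     | yes (z , z≢v , z≢w , f>0″) = uncovered-bound (v ∷ w ∷ z ∷ [])
              ((v≢w All.∷ (z≢v ∘′ sym) All.∷ All.[]) ∷ ((z≢w ∘′ sym) All.∷ All.[]) ∷ All.[] ∷ [])
              (nonspecial-uncovered nospecial f>0 All.∷ nonspecial-uncovered nospecial f>0′ All.∷
               nonspecial-uncovered nospecial f>0″ All.∷ All.[])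
    ...     | no nothird = ≤-trans (cost≤-pair f v w vanish) (subst (f v + f w ≤_) (cong (_∸ 3) (sym n≡))
                             (odd-pair-≤ m (short v≢w f>0 f>0′) (short (v≢w ∘′ sym) f>0′ f>0)))
      where
      vanish : ∀ x → x ≢ v → x ≢ w → f x ≡ 0
      vanish x x≢v x≢w = n≤0⇒n≡0 (≮⇒≥ (λ f>0 → nothird (x , x≢v , x≢w , f>0)))
      short : ∀ {x y} → x ≢ y → 0 < f x → 0 < f y → suc (f x) + suc (f x) ≤ 5 + (m + m)
      short {y = y} x≢y f>0 f>0′ =
        subst (_ ≤_) n≡ (other-broadcast-short x≢y f>0 (bounded-of (nospecial ∘′ (y ,_)) f>0′))

  -- Extremal broadcasts

  module _ {f : V → ℕ} where

    boundary-by-range : ∀ {v} p → 0 < f v → dist n p v ≡ f v → (∀ w → w ≢ v → 0 < f w → f w < dist n p w) →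
                        Boundary f v
    boundary-by-range {v} p f>0 d≡f out-of-range =
      record { point = p ; point∈PN = p∈PN ; point-dist = d≡f ; positive = f>0 }
      where
      hears-only-v : ∀ w → InH n f p w → w ≡ v
      hears-only-v w (f>0′ , d≤f) with w ≟ᶠ v
      ... | yes w≡v = w≡v
      ... | no  w≢v = ⊥-elim (<⇒≱ (out-of-range w w≢v f>0′) d≤f)
      p∈PN : InPN n f v p
      p∈PN w = mk⇔ (hears-only-v w) λ { refl → f>0 , ≤-reflexive d≡f }

    module _ (bc : IsBroadcast n f) (boundary : ∀ v → 0 < f v → Boundary f v) where
      open Boundary

      everywhere-bounded⇒irredundant : IsIrredundant n f
      everywhere-bounded⇒irredundant = bc , λ v f>0 → let b = boundary v f>0 in
        point b , inj₂ ((λ sp → special-no-boundary f sp b) , point∈PN b , point-dist b)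

      -- A dominating g ≤ f must still reach the boundary private neighbour of each v, and only v can.
      everywhere-bounded⇒minimal : IsDominating n f → IsMinimalDominating n f
      everywhere-bounded⇒minimal dom = bc , dom , minimal
        where
        minimal : ∀ g → IsBroadcast n g → IsDominating n g → (∀ v → g v ≤ f v) → ∀ v → g v ≡ f v
        minimal g _ g-dom g≤f v with 0 <? f v
        ... | no  f≯0 = ≤-antisym (g≤f v) (≤-trans (≮⇒≥ f≯0) z≤n)
        ... | yes f>0 = ≤-antisym (g≤f v) (begin
          f v                ≡⟨ point-dist b ⟨
          dist n (point b) v ≤⟨ subst (λ x → dist n (point b) x ≤ g x) w≡v d≤g ⟩
          g v                ∎)
          where
          open ≤-Reasoning
          b = boundary v f>0
          w = proj₁ (g-dom (point b))
          g>0 = proj₁ (proj₂ (g-dom (point b)))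
          d≤g = proj₂ (proj₂ (g-dom (point b)))
          w≡v : w ≡ v
          w≡v = pn-hears-only f (point b) (point∈PN b) (<-≤-trans g>0 (g≤f w) , ≤-trans d≤g (g≤f w))

  IrredundantMinimalDominating : ℕ → Set
  IrredundantMinimalDominating k = ∃[ f ] (IsIrredundant n f × IsMinimalDominating n f × cost n f ≡ k)

  one-centre : ∀ c p {r} → 0 < r → dist n p c ≡ r → (∀ y → dist n y c ≤ r) → IrredundantMinimalDominating r
  one-centre c p {r} r>0 d≡r cover =
    δ c r , everywhere-bounded⇒irredundant bc boundary , everywhere-bounded⇒minimal bc boundary dom , cost-δ c r
    where
    f>0 : 0 < δ c r c
    f>0 = subst (0 <_) (sym (δ-at c r)) r>0
    only-c : ∀ {v} → 0 < δ c r v → v ≡ c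
    only-c {v} f>0′ with v ≟ᶠ c
    ... | yes v≡c = v≡c
    ... | no  _   = ⊥-elim (<-irrefl refl f>0′)
    bc : IsBroadcast n (δ c r)
    bc v with 0 <? δ c r v
    ... | no  f≯0 = v , ≤-trans (≮⇒≥ f≯0) z≤n
    ... | yes f>0′ with only-c f>0′
    ...   | refl = p , ≤-reflexive (trans (δ-at c r) (trans (sym d≡r) (dist-sym p c)))
    boundary : ∀ v → 0 < δ c r v → Boundary (δ c r) v
    boundary v f>0′ with only-c f>0′
    ... | refl = boundary-by-range p f>0 (trans d≡r (sym (δ-at c r))) (λ w w≢c f>0″ → ⊥-elim (w≢c (only-c f>0″)))
    dom : IsDominating n (δ c r)
    dom y = c , f>0 , subst (dist n y c ≤_) (sym (δ-at c r)) (cover y)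

  module _ (c₁ c₂ p₁ p₂ : V) {r} (r>0 : 0 < r) (c₁≢c₂ : c₁ ≢ c₂)
           (d₁₁ : dist n p₁ c₁ ≡ r) (d₁₂ : r < dist n p₁ c₂) (d₂₂ : dist n p₂ c₂ ≡ r) (d₂₁ : r < dist n p₂ c₁)
           (cover : ∀ y → dist n y c₁ ≤ r ⊎ dist n y c₂ ≤ r) where
    private
      f : V → ℕ
      f v = δ c₁ r v + δ c₂ r v

      f-c₁ : f c₁ ≡ r
      f-c₁ = trans (cong₂ _+_ (δ-at c₁ r) (δ-off r c₁≢c₂)) (+-identityʳ r)

      f-c₂ : f c₂ ≡ r
      f-c₂ = cong₂ _+_ (δ-off r (c₁≢c₂ ∘′ sym)) (δ-at c₂ r)

      centres : ∀ v → 0 < f v → v ≡ c₁ ⊎ v ≡ c₂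
      centres v f>0 with v ≟ᶠ c₁ | v ≟ᶠ c₂
      ... | yes v≡c₁ | _        = inj₁ v≡c₁
      ... | no  _    | yes v≡c₂ = inj₂ v≡c₂
      ... | no  _    | no  _    = ⊥-elim (<-irrefl refl f>0)

      bc : IsBroadcast n f
      bc v with 0 <? f v
      ... | no  f≯0 = v , ≤-trans (≮⇒≥ f≯0) z≤n
      ... | yes f>0 with centres v f>0
      ...   | inj₁ refl = p₁ , ≤-reflexive (trans f-c₁ (trans (sym d₁₁) (dist-sym p₁ c₁)))
      ...   | inj₂ refl = p₂ , ≤-reflexive (trans f-c₂ (trans (sym d₂₂) (dist-sym p₂ c₂)))

      boundary : ∀ v → 0 < f v → Boundary f v
      boundary v f>0 with centres v f>0
      ... | inj₁ refl = boundary-by-range p₁ f>0 (trans d₁₁ (sym f-c₁)) λ w w≢c₁ f>0′ →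
        [ (λ w≡c₁ → ⊥-elim (w≢c₁ w≡c₁)) , (λ { refl → subst (_< dist n p₁ c₂) (sym f-c₂) d₁₂ }) ]′ (centres w f>0′)
      ... | inj₂ refl = boundary-by-range p₂ f>0 (trans d₂₂ (sym f-c₂)) λ w w≢c₂ f>0′ →
        [ (λ { refl → subst (_< dist n p₂ c₁) (sym f-c₁) d₂₁ }) , (λ w≡c₂ → ⊥-elim (w≢c₂ w≡c₂)) ]′ (centres w f>0′)

      dom : IsDominating n f
      dom y with cover y
      ... | inj₁ d≤r = c₁ , subst (0 <_) (sym f-c₁) r>0 , subst (dist n y c₁ ≤_) (sym f-c₁) d≤r
      ... | inj₂ d≤r = c₂ , subst (0 <_) (sym f-c₂) r>0 , subst (dist n y c₂ ≤_) (sym f-c₂) d≤r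

    two-centres : IrredundantMinimalDominating (r + r)
    two-centres = f , everywhere-bounded⇒irredundant bc boundary , everywhere-bounded⇒minimal bc boundary dom ,
                  trans (cost-+ (δ c₁ r) (δ c₂ r)) (cong₂ _+_ (cost-δ c₁ r) (cost-δ c₂ r))

  private
    vertex : ∀ a → a < n → V
    vertex a a<n = fromℕ< a<n

    <n : ∀ a k → 0 < k → n ≡ a + k → a < n
    <n a k k>0 n≡ = subst (a <_) (sym n≡) (≤-trans (≤-reflexive (+-comm 1 a)) (+-monoʳ-≤ a k>0))

    dist-offset≤ : ∀ x y e → toℕ y + e ≡ toℕ x → dist n x y ≤ e × dist n x y ≤ n ∸ e
    dist-offset≤ x y e y+e≡x =
      subst (_≤ e) (sym d≡) (m⊓n≤m e (n ∸ e)) , subst (_≤ n ∸ e) (sym d≡) (m⊓n≤n e (n ∸ e))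
      where
      e≤n : e ≤ n
      e≤n = ≤-trans (m≤n+m e (toℕ y)) (≤-trans (≤-reflexive y+e≡x) (<⇒≤ (toℕ<n x)))
      d≡ : dist n x y ≡ e ⊓ (n ∸ e)
      d≡ = dist-offset x y e (n ∸ e) y+e≡x (sym (m+[n∸m]≡n e≤n))

    dist-to-0 : ∀ y {c} → toℕ c ≡ 0 → dist n y c ≤ toℕ y × dist n y c ≤ n ∸ toℕ y
    dist-to-0 y {c} c≡0 = dist-offset≤ y c (toℕ y) (cong (_+ toℕ y) c≡0)

    beyond≤ : ∀ {a y r} → a < y → n ≡ suc a + r → n ∸ y ≤ r
    beyond≤ {a} {y} {r} a<y n≡ =
      ≤-trans (∸-monoʳ-≤ n a<y) (≤-reflexive (trans (cong (_∸ suc a) n≡) (m+n∸m≡n (suc a) r)))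

  module _ (r : ℕ) (r>0 : 0 < r) (n≡ : n ≡ r + r + 1) where
    private
      c<n = >-nonZero⁻¹ n
      p<n = <n r (suc r) (s≤s z≤n) (trans n≡ (solve r))
        where solve : ∀ r → r + r + 1 ≡ r + suc r
              solve = solve-∀
      c = vertex 0 c<n
      p = vertex r p<n

      d≡r : dist n p c ≡ r
      d≡r = trans (dist-offset p c r (suc r) (trans (cong (_+ r) (toℕ-fromℕ< c<n)) (sym (toℕ-fromℕ< p<n)))
                    (trans n≡ (solve r)))
                  (m≤n⇒m⊓n≡m (n≤1+n r))
        where solve : ∀ r → r + r + 1 ≡ r + suc r
              solve = solve-∀

      cover : ∀ y → dist n y c ≤ r
      cover y with toℕ y ≤? r
      ... | yes y≤r = ≤-trans (proj₁ (dist-to-0 y (toℕ-fromℕ< c<n))) y≤r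
      ... | no  y≰r = ≤-trans (proj₂ (dist-to-0 y (toℕ-fromℕ< c<n))) (beyond≤ (≰⇒> y≰r) (trans n≡ (solve r)))
        where solve : ∀ r → r + r + 1 ≡ suc r + r
              solve = solve-∀

    odd-cycle-one-centre : IrredundantMinimalDominating r
    odd-cycle-one-centre = one-centre c p r>0 d≡r cover

  -- Centres 0 and c of radius r, with boundary private neighbours r + c + 1 and r + c.
  module _ (r c : ℕ) (r>0 : 0 < r) (c>0 : 0 < c) (c≤1+r : c ≤ suc r) (n≡ : n ≡ r + r + c + 1) where
    private
      n≡₁ : n ≡ c + (r + r + 1)
      n≡₁ = trans n≡ (solve r c)
        where solve : ∀ r c → r + r + c + 1 ≡ c + (r + r + 1)
              solve = solve-∀
      n≡₂ : n ≡ (r + c) + (r + 1)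
      n≡₂ = trans n≡ (solve r c)
        where solve : ∀ r c → r + r + c + 1 ≡ (r + c) + (r + 1)
              solve = solve-∀
      n≡₃ : n ≡ (r + c + 1) + r
      n≡₃ = trans n≡ (solve r c)
        where solve : ∀ r c → r + r + c + 1 ≡ (r + c + 1) + r
              solve = solve-∀
      n≡₄ : n ≡ (r + 1) + (r + c)
      n≡₄ = trans n≡ (solve r c)
        where solve : ∀ r c → r + r + c + 1 ≡ (r + 1) + (r + c)
              solve = solve-∀

      c₁<n = >-nonZero⁻¹ n
      c₂<n = <n c (r + r + 1) (m≤n+m 1 (r + r)) n≡₁
      p₂<n = <n (r + c) (r + 1) (m≤n+m 1 r) n≡₂
      p₁<n = <n (r + c + 1) r r>0 n≡₃
      c₁ = vertex 0 c₁<n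
      c₂ = vertex c c₂<n
      p₂ = vertex (r + c) p₂<n
      p₁ = vertex (r + c + 1) p₁<n

      offset : ∀ {x y : V} {a b} e → toℕ y ≡ a → toℕ x ≡ b → a + e ≡ b → toℕ y + e ≡ toℕ x
      offset e ty tx a+e≡b = trans (cong (_+ e) ty) (trans a+e≡b (sym tx))

      r<r+c : r < r + c
      r<r+c = m<m+n r c>0
      r<r+1 : r < r + 1
      r<r+1 = m<m+n r (s≤s z≤n)
      r≤r+c+1 : r ≤ r + c + 1
      r≤r+c+1 = ≤-trans (m≤m+n r c) (m≤m+n (r + c) 1)

      c₁≢c₂ : c₁ ≢ c₂
      c₁≢c₂ c₁≡c₂ = <⇒≢ c>0 (trans (sym (toℕ-fromℕ< c₁<n)) (trans (cong toℕ c₁≡c₂) (toℕ-fromℕ< c₂<n)))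

      d₁₁ : dist n p₁ c₁ ≡ r
      d₁₁ = trans (dist-offset p₁ c₁ (r + c + 1) r (offset _ (toℕ-fromℕ< c₁<n) (toℕ-fromℕ< p₁<n) refl) n≡₃)
                  (m≥n⇒m⊓n≡n r≤r+c+1)

      d₁₂ : r < dist n p₁ c₂
      d₁₂ = subst (r <_) (sym (dist-offset p₁ c₂ (r + 1) (r + c) c₂+r+1≡p₁ n≡₄)) (⊓-pres-m< r<r+1 r<r+c)
        where
        solve : ∀ r c → c + (r + 1) ≡ r + c + 1
        solve = solve-∀
        c₂+r+1≡p₁ = offset (r + 1) (toℕ-fromℕ< c₂<n) (toℕ-fromℕ< p₁<n) (solve r c)

      d₂₂ : dist n p₂ c₂ ≡ r
      d₂₂ = trans (dist-offset p₂ c₂ r (r + c + 1) (offset _ (toℕ-fromℕ< c₂<n) (toℕ-fromℕ< p₂<n) (+-comm c r))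
                                 (trans n≡₃ (+-comm (r + c + 1) r)))
                  (m≤n⇒m⊓n≡m r≤r+c+1)

      d₂₁ : r < dist n p₂ c₁
      d₂₁ = subst (r <_)
              (sym (dist-offset p₂ c₁ (r + c) (r + 1) (offset _ (toℕ-fromℕ< c₁<n) (toℕ-fromℕ< p₂<n) refl) n≡₂))
              (⊓-pres-m< r<r+c r<r+1)

      cover : ∀ y → dist n y c₁ ≤ r ⊎ dist n y c₂ ≤ r
      cover y with toℕ y ≤? r
      ... | yes y≤r = inj₁ (≤-trans (proj₁ (dist-to-0 y (toℕ-fromℕ< c₁<n))) y≤r)
      ... | no  y≰r with toℕ y ≤? r + c
      ...   | yes y≤r+c = inj₂ (≤-trans (proj₁ (dist-offset≤ y c₂ (toℕ y ∸ c) c₂+≡y))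
                            (≤-trans (∸-monoˡ-≤ c y≤r+c) (≤-reflexive (m+n∸n≡m r c))))
        where
        c₂+≡y : toℕ c₂ + (toℕ y ∸ c) ≡ toℕ y
        c₂+≡y = trans (cong (_+ (toℕ y ∸ c)) (toℕ-fromℕ< c₂<n)) (m+[n∸m]≡n (≤-trans c≤1+r (≰⇒> y≰r)))
      ...   | no  y≰r+c = inj₁ (≤-trans (proj₂ (dist-to-0 y (toℕ-fromℕ< c₁<n)))
                            (beyond≤ (≰⇒> y≰r+c) (trans n≡₃ (cong (_+ r) (+-comm (r + c) 1)))))

    cycle-two-centres : IrredundantMinimalDominating (r + r)
    cycle-two-centres = two-centres c₁ c₂ p₁ p₂ r>0 c₁≢c₂ d₁₁ d₁₂ d₂₂ d₂₁ cover

  IRb≡Γb : ∀ k → IrredundantMinimalDominating k → (∀ f → IsIrredundant n f → cost n f ≤ k) →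
           IsIRb n k × IsUpperBroadcastDom n k
  IRb≡Γb k (f , irr , md , cost≡k) bound =
    ((f , irr , cost≡k) , bound) , ((f , md , cost≡k) , λ g md′ → bound g (minimalDominating⇒irredundant md′))

  triangle-cycle : n ≡ 3 → IsIRb n 1 × IsUpperBroadcastDom n 1
  triangle-cycle n≡3 = IRb≡Γb 1 (odd-cycle-one-centre 1 ≤-refl n≡3)
    (λ f irr → subst (cost n f ≤_) (cong (_∸ 2) n≡3) (irredundant-cost≤n∸2 irr (≤-reflexive (sym n≡3))))

  even-cycle : ∀ m → n ≡ 4 + (m + m) → IsIRb n (n ∸ 2) × IsUpperBroadcastDom n (n ∸ 2)
  even-cycle m n≡ = IRb≡Γb (n ∸ 2)
    (subst IrredundantMinimalDominating (sym n∸2≡)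
      (cycle-two-centres (suc m) 1 (s≤s z≤n) (s≤s z≤n) (s≤s z≤n) (trans n≡ (solve m))))
    (λ f irr → irredundant-cost≤n∸2 irr (subst (3 ≤_) (sym n≡) (m≤m+n 3 (suc (m + m)))))
    where
    solve : ∀ m → 4 + (m + m) ≡ suc m + suc m + 1 + 1
    solve = solve-∀
    n∸2≡ : n ∸ 2 ≡ suc m + suc m
    n∸2≡ = trans (cong (_∸ 2) n≡) (cong suc (sym (+-suc m m)))

  odd-cycle : ∀ m → n ≡ 5 + (m + m) → IsIRb n (n ∸ 3) × IsUpperBroadcastDom n (n ∸ 3)
  odd-cycle m n≡ = IRb≡Γb (n ∸ 3)
    (subst IrredundantMinimalDominating (sym n∸3≡)
      (cycle-two-centres (suc m) 2 (s≤s z≤n) (s≤s z≤n) (s≤s (s≤s z≤n)) (trans n≡ (solve m))))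
    (λ f irr → irredundant-cost≤n∸3 irr m n≡)
    where
    solve : ∀ m → 5 + (m + m) ≡ suc m + suc m + 2 + 1
    solve = solve-∀
    n∸3≡ : n ∸ 3 ≡ suc m + suc m
    n∸3≡ = trans (cong (_∸ 3) n≡) (cong suc (sym (+-suc m m)))

parity : ∀ j → (∃[ m ] j ≡ m + m) ⊎ (∃[ m ] j ≡ suc (m + m))
parity zero    = inj₁ (0 , refl)
parity (suc j) with parity j
... | inj₁ (m , refl) = inj₂ (m , refl)
... | inj₂ (m , refl) = inj₁ (suc m , cong suc (sym (+-suc m m)))

data Order≥3 : ℕ → Set where
  three : Order≥3 3
  even  : ∀ m → Order≥3 (4 + (m + m))
  odd   : ∀ m → Order≥3 (5 + (m + m))

order≥3 : ∀ n → 3 ≤ n → Order≥3 n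
order≥3 (suc (suc (suc zero)))    (s≤s (s≤s (s≤s z≤n))) = three
order≥3 (suc (suc (suc (suc j)))) (s≤s (s≤s (s≤s z≤n))) with parity j
... | inj₁ (m , refl) = even m
... | inj₂ (m , refl) = odd m

theorem3p3 : (n : ℕ) → 3 ≤ n → ∃[ k ] (IsIRb n k × IsUpperBroadcastDom n k)
theorem3p3 n 3≤n with order≥3 n 3≤n
... | three  = -, Cycle.triangle-cycle 3 refl
... | even m = -, Cycle.even-cycle (4 + (m + m)) m refl
... | odd m  = -, Cycle.odd-cycle (5 + (m + m)) m refl
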